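{- Let $\mathfrak X_1$ and $\mathfrak X_2$ be topological spaces and suppose $\mathfrak X_1$ is weakly scattered. Then the formula $\Diamond_1\Box_2(\Diamond_1 p \to \Box_1 p)$ is valid in the bitopological product $\mathfrak X_1\times\mathfrak X_2$.
   Context: A point $x$ of a topological space is isolated if $\{x\}$ is open; a space is weakly scattered if every nonempty open set contains an isolated point. For topological spaces $\mathfrak X_1=(X_1,T_1)$, $\mathfrak X_2=(X_2,T_2)$, the bitopological product is $\mathfrak X_1\times\mathfrak X_2=(X_1\times X_2, T_1^h, T_2^v)$, where $T_1^h$ has base $\{U\times\{x_2\}: U\in T_1, x_2\in X_2\}$ and $T_2^v$ has base $\{\{x_1\}\times U: x_1\in X_1, U\in T_2\}$. Bimodal formulas are interpreted with $\Box_i$ via topology $i$: $x\models\Box_i A$ iff there is a $T_i$-open $U\ni x$ with $A$ true at every point of $U$; $\Diamond_i=\lnot\Box_i\lnot$. Validity means truth at every point under every valuation. -}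

module Defs where

open import Data.Nat using (ℕ)
open import Data.Product using (Σ; _×_; _,_; ∃)
open import Data.Empty using (⊥)
open import Data.Unit using (⊤)
open import Level using (Lift; lift)
open import Relation.Binary.PropositionalEquality using (_≡_)

Subset : Set → Set₁
Subset X = X → Set

record TopSpace : Set₂ where
  field
    Carrier : Set
    Open    : Subset Carrier → Set
    open-ext   : ∀ (U V : Subset Carrier) → (∀ x → U x → V x) → (∀ x → V x → U x) → Open U → Open V
    open-whole : Open (λ _ → ⊤)
    open-empty : Open (λ _ → ⊥)
    open-∩     : ∀ U V → Open U → Open V → Open (λ x → U x × V x)
    open-⋃     : ∀ (I : Set) (F : I → Subset Carrier) → (∀ i → Open (F i)) →
                   Open (λ x → Σ I (λ i → F i x))

open TopSpace public

Isolated : (T : TopSpace) → Carrier T → Set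
Isolated T x = Open T (λ y → y ≡ x)

WeaklyScattered : TopSpace → Set₁
WeaklyScattered T = ∀ (U : Subset (Carrier T)) → Open T U → (∃ λ x → U x) →
                    ∃ λ x → U x × Isolated T x

record BiSpace : Set₂ where
  field
    BCarrier : Set
    Open₁ : Subset BCarrier → Set₁
    Open₂ : Subset BCarrier → Set₁

open BiSpace public

-- Bitopological product X₁ × X₂ = (X₁ × X₂, T₁ʰ, T₂ᵛ), each topology being the
-- one generated by the stated base: W is open iff every point of W lies in a
-- base element contained in W.
_⊠_ : TopSpace → TopSpace → BiSpace
T₁ ⊠ T₂ = record
  { BCarrier = Carrier T₁ × Carrier T₂
  ; Open₁ = λ W → ∀ a b → W (a , b) →
              Σ (Subset (Carrier T₁)) λ U → Open T₁ U × U a ×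
                (∀ a' → U a' → W (a' , b))
  ; Open₂ = λ W → ∀ a b → W (a , b) →
              Σ (Subset (Carrier T₂)) λ U → Open T₂ U × U b ×
                (∀ b' → U b' → W (a , b'))
  }

data Mod : Set where
  m₁ m₂ : Mod

data Fml : Set where
  var  : ℕ → Fml
  ⊥'   : Fml
  _⇒_  : Fml → Fml → Fml
  □    : Mod → Fml → Fml
  ◇    : Mod → Fml → Fml

infixr 5 _⇒_

OpenM : (B : BiSpace) → Mod → Subset (BCarrier B) → Set₁
OpenM B m₁ = Open₁ B
OpenM B m₂ = Open₂ B

-- Topological semantics.  ◇ᵢ A holds at x iff every Tᵢ-open U ∋ x contains a
-- point satisfying A (the classical unfolding of ¬□ᵢ¬A).
_,_⊨_at_ : (B : BiSpace) → (ℕ → Subset (BCarrier B)) → Fml → BCarrier B → Set₁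
B , V ⊨ var n at x = Lift _ (V n x)
B , V ⊨ ⊥' at x = Lift _ ⊥
B , V ⊨ (A ⇒ C) at x = B , V ⊨ A at x → B , V ⊨ C at x
B , V ⊨ □ i A at x = Σ (Subset (BCarrier B)) λ U →
                       OpenM B i U × U x × (∀ y → U y → B , V ⊨ A at y)
B , V ⊨ ◇ i A at x = ∀ (U : Subset (BCarrier B)) → OpenM B i U → U x →
                       Σ (BCarrier B) λ y → U y × B , V ⊨ A at y

Valid : BiSpace → Fml → Set₁
Valid B A = ∀ (V : ℕ → Subset (BCarrier B)) (x : BCarrier B) → B , V ⊨ A at x

{-# OPTIONS --safe #-}
module Submission where

open import Defs
open import Data.Nat using (ℕ)
open import Data.Product using (_×_; _,_; ∃; proj₁)
open import Data.Unit using (tt)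
open import Relation.Binary.PropositionalEquality using (_≡_; refl; cong)

-- Every horizontal neighbourhood of (a , b) contains a point (a' , b) with a'
-- isolated in X₁.  The vertical line through a' is T₂-open, and every point
-- of it is T₁-isolated in the product, where ◇₁ p → □₁ p holds trivially.

◇⇒□-at-open-singleton : (B : BiSpace) (V : ℕ → Subset (BCarrier B)) (i : Mod)
                        (A : Fml) {x : BCarrier B} → OpenM B i (_≡ x) →
                        B , V ⊨ (◇ i A ⇒ □ i A) at x
◇⇒□-at-open-singleton B V i A {x} open-x ◇A = (_≡ x) , open-x , refl , A-on-x
  where
  A-on-x : ∀ y → y ≡ x → B , V ⊨ A at y
  A-on-x y refl with ◇A (_≡ x) open-x refl
  ... | _ , refl , Ax = Ax

module _ (X₁ X₂ : TopSpace) where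

  isolated⇒open₁-singleton : ∀ {a} → Isolated X₁ a → (b : Carrier X₂) →
                             Open₁ (X₁ ⊠ X₂) (_≡ (a , b))
  isolated⇒open₁-singleton {a} isolated-a b .a .b refl =
    (_≡ a) , isolated-a , refl , λ a' a'≡a → cong (_, b) a'≡a

  vertical-line-open₂ : (a : Carrier X₁) → Open₂ (X₁ ⊠ X₂) (λ z → proj₁ z ≡ a)
  vertical-line-open₂ a x y x≡a = (λ _ → _) , open-whole X₂ , tt , λ _ _ → x≡a

  open₁-contains-isolated : WeaklyScattered X₁ → ∀ {W a b} →
                            Open₁ (X₁ ⊠ X₂) W → W (a , b) →
                            ∃ λ a' → Isolated X₁ a' × W (a' , b)
  open₁-contains-isolated scattered {W} {a} {b} open-W Wab
    with open-W a b Wab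
  ... | U , open-U , Ua , U×b⊆W with scattered U open-U (a , Ua)
  ...   | a' , Ua' , isolated-a' = a' , isolated-a' , U×b⊆W a' Ua'

mainTheorem2 : (X₁ X₂ : TopSpace) → WeaklyScattered X₁ →
    Valid (X₁ ⊠ X₂) (◇ m₁ (□ m₂ (◇ m₁ (var 0) ⇒ □ m₁ (var 0))))
mainTheorem2 X₁ X₂ scattered V (a , b) W open-W Wab
  with open₁-contains-isolated X₁ X₂ scattered open-W Wab
... | a' , isolated-a' , Wa'b =
  (a' , b) , Wa'b , (λ z → proj₁ z ≡ a') , vertical-line-open₂ X₁ X₂ a' , refl ,
  λ { (.a' , y) refl → ◇⇒□-at-open-singleton (X₁ ⊠ X₂) V m₁ (var 0)
                         (isolated⇒open₁-singleton X₁ X₂ isolated-a' y) }
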